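{- Let $s\in\mathbb{Z}\setminus\{0\}$, $t\in\mathbb{Z}_{\ge1}$ with $\gcd(s,t)=1$. Let $(A_n)_{n\ge0}$, $(B_n)_{n\ge0}$ satisfy $C_n=2t(2n+1)C_{n-1}+s^2C_{n-2}$ for $n\ge2$, with $A_0=0$, $B_0=1$, $A_1=s^2$, $B_1=6t$, and set $C_n^{\pm}=A_n+(2t\pm s)B_n$. For $n\ge0$ let \[ D_n=\prod_{p\text{ prime},\ v_p(s)\ge1}p^{r_p(n)},\qquad r_2(n)=n+1,\quad r_p(n)=v_p((n+1)!)\ (p\ge3). \] Then $D_n$ divides $\gcd(C_n^+,C_n^-)$ for every $n\ge0$.
   Context: $v_p$ denotes the $p$-adic valuation. ($A_n/B_n$ are the convergents of the continued fraction $\mathrm{K}_{n=1}^{\infty}\frac{s^2}{2t(2n+1)}$.) -}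

module Defs where

open import Data.Nat as ℕ using (ℕ; zero; suc; _^_; _!; _≡ᵇ_)
open import Data.Nat.Divisibility using (_∣?_)
open import Data.Nat.Primality using (prime?)
open import Data.Nat.DivMod using (_/_)
open import Data.Integer as ℤ using (ℤ; +_)
open import Data.Bool using (if_then_else_; _∧_; not)
open import Relation.Nullary.Decidable using (does)

rec : ℤ → ℤ → ℤ → ℤ → ℕ → ℤ
rec s t c0 c1 zero = c0
rec s t c0 c1 (suc zero) = c1
rec s t c0 c1 (suc (suc m)) =
  (+ 2) ℤ.* t ℤ.* (+ (2 ℕ.* (suc (suc m)) ℕ.+ 1)) ℤ.* rec s t c0 c1 (suc m)
  ℤ.+ s ℤ.* s ℤ.* rec s t c0 c1 m

A : ℤ → ℤ → ℕ → ℤ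
A s t = rec s t (+ 0) (s ℤ.* s)

B : ℤ → ℤ → ℕ → ℤ
B s t = rec s t (+ 1) ((+ 6) ℤ.* t)

C⁺ : ℤ → ℤ → ℕ → ℤ
C⁺ s t n = A s t n ℤ.+ ((+ 2) ℤ.* t ℤ.+ s) ℤ.* B s t n

C⁻ : ℤ → ℤ → ℕ → ℤ
C⁻ s t n = A s t n ℤ.+ ((+ 2) ℤ.* t ℤ.- s) ℤ.* B s t n

valAux : ℕ → ℕ → ℕ → ℕ
valAux zero p m = 0
valAux (suc fuel) p m =
  if does (2 ℕ.≤? p) ∧ not (m ≡ᵇ 0) ∧ does (p ∣? m)
  then suc (valAux fuel p (m / suc (ℕ.pred p)))
  else 0

v : ℕ → ℕ → ℕ
v p m = valAux m p m

r : ℕ → ℕ → ℕ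
r p n = if p ≡ᵇ 2 then suc n else v p (suc n !)

prod : (ℕ → ℕ) → ℕ → ℕ
prod f zero = 1
prod f (suc N) = prod f N ℕ.* f (suc N)

-- D_n = ∏_{p prime, p ∣ s} p^{r_p(n)}  (primes dividing s are ≤ |s|, s ≠ 0)
D : ℤ → ℕ → ℕ
D s n = prod (λ p → if does (prime? p) ∧ does (p ∣? ℤ.∣ s ∣) then p ^ r p n else 1) ℤ.∣ s ∣

module Submission where

-- C⁺_n is the antidiagonal sum Σ_{k+j=n+1} a(k,j) s^k t^j with a(k,j) = (k+2j)!/(k! j!),
-- and C⁻_n is the same sum at -s: both sides satisfy the recurrence of C_n, which sees s
-- only through s². So it suffices that p^{r_p(n)} divides a(k,j) s^k whenever p is a prime
-- dividing s and k + j = n + 1. For p = 2 this holds because 2^j ∣ a(k,j) and 2^k ∣ s^k.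
-- For odd p, (n+1)! = (k+j)! divides a(k,j) k!, and k! divides p^k W with p ∤ W (Legendre,
-- via k! = p^q q! R with p ∤ R and 2q ≤ k), so k! can be traded for p^k ∣ s^k.

module PrimePowers where
  open import Data.Nat
  open import Data.Nat.Properties
  open import Data.Nat.Divisibility
  open import Data.Nat.DivMod using (_/_; m*[n/m]≡n)
  open import Data.Nat.Coprimality using (Coprime; coprime-divisor)
  import Data.Nat.Coprimality as Coprime
  open import Data.Nat.Induction using (<-rec)
  open import Data.Nat.Primality
  open import Data.Nat.Tactic.RingSolver using (solve-∀)
  open import Data.Bool using (if_then_else_)
  open import Data.Empty using (⊥-elim)
  open import Data.Product using (∃-syntax; _×_; _,_)
  open import Data.Sum using (inj₁; inj₂)
  open import Relation.Nullary using (¬_; Dec; does; yes; no)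
  open import Relation.Binary.PropositionalEquality
  open import Defs using (valAux)

  p^valAux∣m : ∀ fuel p m → p ^ valAux fuel p m ∣ m
  p^valAux∣m zero p m = 1∣ m
  p^valAux∣m (suc fuel) 0 m = 1∣ m
  p^valAux∣m (suc fuel) 1 m = 1∣ m
  p^valAux∣m (suc fuel) (suc (suc q)) 0 = 1∣ 0
  p^valAux∣m (suc fuel) p@(suc (suc q)) (suc m) = step (p ∣? suc m)
    where
    step : (p∣m? : Dec (p ∣ suc m)) →
           p ^ (if does p∣m? then suc (valAux fuel p (suc m / p)) else 0) ∣ suc m
    step (yes p∣m) = subst (p ^ suc (valAux fuel p (suc m / p)) ∣_) (m*[n/m]≡n p∣m)
                       (*-monoʳ-∣ p (p^valAux∣m fuel p (suc m / p)))
    step (no _) = 1∣ suc m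

  prime⇒¬∣1 : ∀ {p} → Prime p → ¬ p ∣ 1
  prime⇒¬∣1 pp p∣1 = nonTrivial⇒≢1 ⦃ prime⇒nonTrivial pp ⦄ (∣1⇒≡1 p∣1)

  prime∣^⇒∣ : ∀ {p} m e → Prime p → p ∣ m ^ e → p ∣ m
  prime∣^⇒∣ m zero pp p∣1 = ⊥-elim (prime⇒¬∣1 pp p∣1)
  prime∣^⇒∣ m (suc e) pp p∣m^e with euclidsLemma m (m ^ e) pp p∣m^e
  ... | inj₁ p∣m = p∣m
  ... | inj₂ p∣m^e = prime∣^⇒∣ m e pp p∣m^e

  ¬∣⇒coprime-^ : ∀ {p m} e → Prime p → ¬ p ∣ m → Coprime m (p ^ e)
  ¬∣⇒coprime-^ zero pp p∤m (_ , d∣1) = ∣1⇒≡1 d∣1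
  ¬∣⇒coprime-^ {p} {m} (suc e) pp p∤m {d} (d∣m , d∣p^e+1) =
    ¬∣⇒coprime-^ e pp p∤m (d∣m , coprime-divisor d⊥p d∣p^e+1)
    where
    d⊥p : Coprime d p
    d⊥p {c} (c∣d , c∣p) with prime⇒irreducible pp c∣p
    ... | inj₁ c≡1 = c≡1
    ... | inj₂ refl = ⊥-elim (p∤m (∣-trans c∣d d∣m))

  coprime⇒*-∣ : ∀ {m n o} → Coprime m n → m ∣ o → n ∣ o → m * n ∣ o
  coprime⇒*-∣ {m} {n} m⊥n m∣o (divides q refl) =
    *-monoˡ-∣ n (coprime-divisor m⊥n (subst (m ∣_) (*-comm q n) m∣o))

  ^-monoˡ-∣ : ∀ {m n} k → m ∣ n → m ^ k ∣ n ^ k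
  ^-monoˡ-∣ zero _ = ∣-refl
  ^-monoˡ-∣ (suc k) m∣n = *-pres-∣ m∣n (^-monoˡ-∣ k m∣n)

  ^-monoʳ-∣ : ∀ p {m n} → m ≤ n → p ^ m ∣ p ^ n
  ^-monoʳ-∣ p {m} {n} m≤n = divides (p ^ (n ∸ m))
    (trans (cong (p ^_) (sym (m∸n+n≡m m≤n))) (^-distribˡ-+-* p (n ∸ m) m))

  m+m≤1+n⇒m≤n : ∀ m {n} → m + m ≤ suc n → m ≤ n
  m+m≤1+n⇒m≤n zero _ = z≤n
  m+m≤1+n⇒m≤n (suc m) {n} (s≤s m+1+m≤n) =
    ≤-trans (s≤s (m≤n+m m m)) (subst (_≤ n) (+-suc m m) m+1+m≤n)

  module _ {p : ℕ} (pp : Prime p) where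
    private instance
      p≢0 : NonZero p
      p≢0 = prime⇒nonZero pp

    ¬∣-rem : ∀ q {r} → 0 < r → r < p → ¬ p ∣ q * p + r
    ¬∣-rem q 0<r r<p p∣ = <⇒≱ r<p (∣⇒≤ ⦃ >-nonZero 0<r ⦄ (∣m+n∣m⇒∣n p∣ (n∣m*n q)))

    record FactorialSplit (k : ℕ) : Set where
      field
        quot rem cofactor : ℕ
        division : k ≡ quot * p + rem
        rem<p : rem < p
        p∤cofactor : ¬ p ∣ cofactor
        factorial : k ! ≡ p ^ quot * quot ! * cofactor

    factorialSplit : ∀ k → FactorialSplit k
    factorialSplit zero = record
      { quot = 0 ; rem = 0 ; cofactor = 1 ; division = refl
      ; rem<p = >-nonZero⁻¹ p ; p∤cofactor = prime⇒¬∣1 pp ; factorial = refl }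
    factorialSplit (suc k) with factorialSplit k
    ... | record { quot = q ; rem = r ; cofactor = R ; division = k≡ ; rem<p = r<p
                 ; p∤cofactor = p∤R ; factorial = k!≡ } with m≤n⇒m<n∨m≡n r<p
    ... | inj₁ 1+r<p = record
      { quot = q ; rem = suc r ; cofactor = suc k * R ; division = 1+k≡
      ; rem<p = 1+r<p ; p∤cofactor = p∤[1+k]*R
      ; factorial = trans (cong (suc k *_) k!≡) (regroup (suc k) (p ^ q) (q !) R) }
      where
      1+k≡ : suc k ≡ q * p + suc r
      1+k≡ = trans (cong suc k≡) (sym (+-suc (q * p) r))
      p∤[1+k]*R : ¬ p ∣ suc k * R
      p∤[1+k]*R p∣ with euclidsLemma (suc k) R pp p∣
      ... | inj₁ p∣1+k = ¬∣-rem q (s≤s z≤n) 1+r<p (subst (p ∣_) 1+k≡ p∣1+k)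
      ... | inj₂ p∣R = p∤R p∣R
      regroup : ∀ a b c d → a * (b * c * d) ≡ b * c * (a * d)
      regroup = solve-∀
    ... | inj₂ 1+r≡p = record
      { quot = suc q ; rem = 0 ; cofactor = R ; division = trans 1+k≡ (sym (+-identityʳ _))
      ; rem<p = >-nonZero⁻¹ p ; p∤cofactor = p∤R
      ; factorial = trans (cong₂ _*_ 1+k≡ k!≡) (regroup q p (p ^ q) (q !) R) }
      where
      1+k≡ : suc k ≡ suc q * p
      1+k≡ = begin
        suc k           ≡⟨ cong suc k≡ ⟩
        suc (q * p + r) ≡⟨ +-suc (q * p) r ⟨
        q * p + suc r   ≡⟨ cong (q * p +_) 1+r≡p ⟩
        q * p + p       ≡⟨ +-comm (q * p) p ⟩
        suc q * p       ∎
        where open ≡-Reasoning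
      regroup : ∀ q p a b c → suc q * p * (a * b * c) ≡ p * a * (suc q * b) * c
      regroup = solve-∀

    quot+quot≤ : ∀ {k} (s : FactorialSplit k) → FactorialSplit.quot s + FactorialSplit.quot s ≤ k
    quot+quot≤ {k} record { quot = q ; rem = r ; division = k≡ } = begin
      q + q     ≡⟨ cong (q +_) (+-identityʳ q) ⟨
      2 * q     ≤⟨ *-monoˡ-≤ q (nonTrivial⇒n>1 p ⦃ prime⇒nonTrivial pp ⦄) ⟩
      p * q     ≡⟨ *-comm p q ⟩
      q * p     ≤⟨ m≤m+n (q * p) r ⟩
      q * p + r ≡⟨ k≡ ⟨
      k         ∎
      where open ≤-Reasoning

    k!∣p^k*coprime : ∀ k → ∃[ W ] ¬ p ∣ W × k ! ∣ p ^ k * W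
    k!∣p^k*coprime = <-rec _ step
      where
      step : ∀ k → (∀ {m} → m < k → ∃[ W ] ¬ p ∣ W × m ! ∣ p ^ m * W) →
             ∃[ W ] ¬ p ∣ W × k ! ∣ p ^ k * W
      step zero _ = 1 , prime⇒¬∣1 pp , ∣-refl
      step (suc k) rec with factorialSplit (suc k)
      ... | s@record { quot = q ; cofactor = R ; p∤cofactor = p∤R ; factorial = [1+k]!≡ }
        with rec {q} (s≤s (m+m≤1+n⇒m≤n q (quot+quot≤ s)))
      ... | W , p∤W , q!∣ = W * R , p∤W*R , [1+k]!∣
        where
        p∤W*R : ¬ p ∣ W * R
        p∤W*R p∣ with euclidsLemma W R pp p∣
        ... | inj₁ p∣W = p∤W p∣W
        ... | inj₂ p∣R = p∤R p∣R
        [1+k]!∣ : suc k ! ∣ p ^ suc k * (W * R)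
        [1+k]!∣ = begin
          suc k !                  ≡⟨ [1+k]!≡ ⟩
          p ^ q * q ! * R          ∣⟨ *-monoˡ-∣ R (*-monoʳ-∣ (p ^ q) q!∣) ⟩
          p ^ q * (p ^ q * W) * R  ≡⟨ regroup (p ^ q) W R ⟩
          p ^ q * p ^ q * (W * R)  ≡⟨ cong (_* (W * R)) (^-distribˡ-+-* p q q) ⟨
          p ^ (q + q) * (W * R)    ∣⟨ *-monoˡ-∣ (W * R) (^-monoʳ-∣ p (quot+quot≤ s)) ⟩
          p ^ suc k * (W * R)      ∎
          where
          open ∣-Reasoning
          regroup : ∀ a w r → a * (a * w) * r ≡ a * a * (w * r)
          regroup = solve-∀

    p^e∣a*k!⇒p^e∣a*p^k : ∀ {e a} k → p ^ e ∣ a * k ! → p ^ e ∣ a * p ^ k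
    p^e∣a*k!⇒p^e∣a*p^k {e} {a} k p^e∣a*k! with k!∣p^k*coprime k
    ... | W , p∤W , k!∣ = coprime-divisor (Coprime.sym (¬∣⇒coprime-^ e pp p∤W))
      (∣-trans p^e∣a*k! (∣-trans (*-monoʳ-∣ a k!∣) (∣-reflexive (regroup a (p ^ k) W))))
      where
      regroup : ∀ a x w → a * (x * w) ≡ w * (a * x)
      regroup = solve-∀

module Coefficients where
  open import Data.Nat
  open import Data.Nat.Properties
  open import Data.Nat.Divisibility
  open import Data.Nat.Combinatorics using (k![n∸k]!∣n!)
  open import Data.Nat.Tactic.RingSolver using (solve-∀)
  open import Relation.Binary.PropositionalEquality

  -- coeff k j is the coefficient of s^k t^j in C⁺_{k+j-1}; the recursion is the
  -- recurrence of C_n read off coefficientwise.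
  coeff : ℕ → ℕ → ℕ
  coeff k zero = 1
  coeff 0 (suc j) = 2 * (2 * j + 1) * coeff 0 j
  coeff 1 (suc j) = 2 * (2 * (1 + j) + 1) * coeff 1 j
  coeff (suc (suc k)) (suc j) = 2 * (2 * (2 + k + j) + 1) * coeff (2 + k) j + coeff k (suc j)

  2^j∣a⇒2^[1+j]∣2*c*a : ∀ {j a} c → 2 ^ j ∣ a → 2 ^ suc j ∣ 2 * c * a
  2^j∣a⇒2^[1+j]∣2*c*a {j} {a} c = *-pres-∣ {2} {2 * c} {2 ^ j} {a} (m∣m*n c)

  2^j∣coeff : ∀ k j → 2 ^ j ∣ coeff k j
  2^j∣coeff k zero = ∣-refl
  2^j∣coeff 0 (suc j) = 2^j∣a⇒2^[1+j]∣2*c*a {j} (2 * j + 1) (2^j∣coeff 0 j)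
  2^j∣coeff 1 (suc j) = 2^j∣a⇒2^[1+j]∣2*c*a {j} (2 * (1 + j) + 1) (2^j∣coeff 1 j)
  2^j∣coeff (suc (suc k)) (suc j) = ∣m∣n⇒∣m+n
    (2^j∣a⇒2^[1+j]∣2*c*a {j} (2 * (2 + k + j) + 1) (2^j∣coeff (2 + k) j))
    (2^j∣coeff k (suc j))

  k+[2+2j]≡2+[k+2j] : ∀ k j → k + (suc j + suc j) ≡ 2 + (k + (j + j))
  k+[2+2j]≡2+[k+2j] k j = begin
    k + (suc j + suc j)   ≡⟨ cong (k +_) (cong suc (+-suc j j)) ⟩
    k + suc (suc (j + j)) ≡⟨ +-suc k (suc (j + j)) ⟩
    suc (k + suc (j + j)) ≡⟨ cong suc (+-suc k (j + j)) ⟩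
    2 + (k + (j + j))     ∎
    where open ≡-Reasoning

  [2+n]!≡ : ∀ n → (2 + n) ! ≡ (2 + n) * (1 + n) * n !
  [2+n]!≡ n = sym (*-assoc (2 + n) (1 + n) (n !))

  coeff*k!*j!≡[k+2j]! : ∀ k j → coeff k j * (k ! * j !) ≡ (k + (j + j)) !
  coeff*k!*j!≡[k+2j]! k zero =
    trans (*-identityˡ (k ! * 1)) (trans (*-identityʳ (k !)) (cong _! (sym (+-identityʳ k))))
  coeff*k!*j!≡[k+2j]! 0 (suc j) = begin
    2 * (2 * j + 1) * a * (1 * ((1 + j) * j !))     ≡⟨ regroup j a (j !) ⟩
    (2 + (j + j)) * (1 + (j + j)) * (a * (1 * j !)) ≡⟨ cong (w *_) (coeff*k!*j!≡[k+2j]! 0 j) ⟩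
    (2 + (j + j)) * (1 + (j + j)) * (j + j) !       ≡⟨ [2+n]!≡ (j + j) ⟨
    (2 + (j + j)) !                                 ≡⟨ cong _! (k+[2+2j]≡2+[k+2j] 0 j) ⟨
    (suc j + suc j) !                               ∎
    where
    open ≡-Reasoning
    a = coeff 0 j
    w = (2 + (j + j)) * (1 + (j + j))
    regroup : ∀ j a f → 2 * (2 * j + 1) * a * (1 * ((1 + j) * f))
                      ≡ (2 + (j + j)) * (1 + (j + j)) * (a * (1 * f))
    regroup = solve-∀
  coeff*k!*j!≡[k+2j]! 1 (suc j) = begin
    2 * (2 * (1 + j) + 1) * a * (1 * 1 * ((1 + j) * j !)) ≡⟨ regroup j a (j !) ⟩
    (3 + (j + j)) * (2 + (j + j)) * (a * (1 * 1 * j !))   ≡⟨ cong (w *_) (coeff*k!*j!≡[k+2j]! 1 j) ⟩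
    (3 + (j + j)) * (2 + (j + j)) * (1 + (j + j)) !       ≡⟨ [2+n]!≡ (1 + (j + j)) ⟨
    (3 + (j + j)) !                                       ≡⟨ cong _! (k+[2+2j]≡2+[k+2j] 1 j) ⟨
    (1 + (suc j + suc j)) !                               ∎
    where
    open ≡-Reasoning
    a = coeff 1 j
    w = (3 + (j + j)) * (2 + (j + j))
    regroup : ∀ j a f → 2 * (2 * (1 + j) + 1) * a * (1 * 1 * ((1 + j) * f))
                      ≡ (3 + (j + j)) * (2 + (j + j)) * (a * (1 * 1 * f))
    regroup = solve-∀
  coeff*k!*j!≡[k+2j]! (suc (suc k)) (suc j) = begin
    (c * a₁ + a₂) * ((2 + k) * ((1 + k) * k !) * ((1 + j) * j !))
      ≡⟨ regroup k j a₁ a₂ (k !) (j !) ⟩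
    c * (1 + j) * (a₁ * ((2 + k) * ((1 + k) * k !) * j !)) + (2 + k) * (1 + k) * (a₂ * (k ! * ((1 + j) * j !)))
      ≡⟨ cong₂ (λ x y → c * (1 + j) * x + (2 + k) * (1 + k) * y)
           (coeff*k!*j!≡[k+2j]! (2 + k) j)
           (trans (coeff*k!*j!≡[k+2j]! k (suc j)) (cong _! (k+[2+2j]≡2+[k+2j] k j))) ⟩
    c * (1 + j) * F + (2 + k) * (1 + k) * F
      ≡⟨ weight-sum k j F ⟩
    (4 + (k + (j + j))) * (3 + (k + (j + j))) * F
      ≡⟨ [2+n]!≡ (2 + (k + (j + j))) ⟨
    (4 + (k + (j + j))) !
      ≡⟨ cong (λ n → (2 + n) !) (k+[2+2j]≡2+[k+2j] k j) ⟨
    (2 + k + (suc j + suc j)) ! ∎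
    where
    open ≡-Reasoning
    c = 2 * (2 * (2 + k + j) + 1)
    a₁ = coeff (2 + k) j
    a₂ = coeff k (suc j)
    F = (2 + (k + (j + j))) !
    regroup : ∀ k j a₁ a₂ f g →
      (2 * (2 * (2 + k + j) + 1) * a₁ + a₂) * ((2 + k) * ((1 + k) * f) * ((1 + j) * g))
      ≡ 2 * (2 * (2 + k + j) + 1) * (1 + j) * (a₁ * ((2 + k) * ((1 + k) * f) * g))
        + (2 + k) * (1 + k) * (a₂ * (f * ((1 + j) * g)))
    regroup = solve-∀
    weight-sum : ∀ k j F → 2 * (2 * (2 + k + j) + 1) * (1 + j) * F + (2 + k) * (1 + k) * F
                         ≡ (4 + (k + (j + j))) * (3 + (k + (j + j))) * F
    weight-sum = solve-∀

  [k+j]!∣coeff*k! : ∀ k j → (k + j) ! ∣ coeff k j * k !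
  [k+j]!∣coeff*k! k j = *-cancelˡ-∣ (j !) ⦃ j !≢0 ⦄ (begin
    j ! * (k + j) !           ≡⟨ cong (λ n → j ! * n !) [k+2j]∸j≡k+j ⟨
    j ! * (k + (j + j) ∸ j) ! ∣⟨ k![n∸k]!∣n! (≤-trans (m≤n+m j j) (m≤n+m (j + j) k)) ⟩
    (k + (j + j)) !           ≡⟨ coeff*k!*j!≡[k+2j]! k j ⟨
    coeff k j * (k ! * j !)   ≡⟨ regroup (coeff k j) (k !) (j !) ⟩
    j ! * (coeff k j * k !)   ∎)
    where
    open ∣-Reasoning
    [k+2j]∸j≡k+j : k + (j + j) ∸ j ≡ k + j
    [k+2j]∸j≡k+j = trans (cong (_∸ j) (sym (+-assoc k j j))) (m+n∸n≡m (k + j) j)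
    regroup : ∀ a x y → a * (x * y) ≡ y * (a * x)
    regroup = solve-∀

module ClosedForm where
  open import Data.Nat as ℕ using (ℕ; zero; suc)
  open import Data.Integer using (ℤ; +_; 0ℤ; _+_; _*_; -_; _^_)
  open import Data.Integer.Properties using (pos-*; pos-+; +-identityˡ; +-identityʳ; *-distribˡ-+)
  open import Data.Integer.Divisibility.Signed using (_∣_; ∣m∣n⇒∣m+n)
  open import Data.Integer.Tactic.RingSolver using (solve-∀)
  open import Relation.Binary.PropositionalEquality
  open import Defs using (rec; A; B; C⁺; C⁻)
  open Coefficients using (coeff)

  antidiagonalSum : (ℕ → ℕ → ℤ) → ℕ → ℤ
  antidiagonalSum f zero = f 0 0
  antidiagonalSum f (suc m) = f 0 (suc m) + antidiagonalSum (λ k j → f (suc k) j) m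

  antidiagonalSum-cong : ∀ {f g} m → (∀ k j → k ℕ.+ j ≡ m → f k j ≡ g k j) →
                         antidiagonalSum f m ≡ antidiagonalSum g m
  antidiagonalSum-cong zero f≡g = f≡g 0 0 refl
  antidiagonalSum-cong (suc m) f≡g =
    cong₂ _+_ (f≡g 0 (suc m) refl) (antidiagonalSum-cong m (λ k j e → f≡g (suc k) j (cong suc e)))

  antidiagonalSum-+ : ∀ f g m →
    antidiagonalSum (λ k j → f k j + g k j) m ≡ antidiagonalSum f m + antidiagonalSum g m
  antidiagonalSum-+ f g zero = refl
  antidiagonalSum-+ f g (suc m) = trans
    (cong (_+_ (f 0 (suc m) + g 0 (suc m)))
          (antidiagonalSum-+ (λ k j → f (suc k) j) (λ k j → g (suc k) j) m))
    (interchange (f 0 (suc m)) (g 0 (suc m)) _ _)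
    where
    interchange : ∀ a b c d → (a + b) + (c + d) ≡ (a + c) + (b + d)
    interchange = solve-∀

  antidiagonalSum-* : ∀ c f m → antidiagonalSum (λ k j → c * f k j) m ≡ c * antidiagonalSum f m
  antidiagonalSum-* c f zero = refl
  antidiagonalSum-* c f (suc m) = trans
    (cong (_+_ (c * f 0 (suc m))) (antidiagonalSum-* c (λ k j → f (suc k) j) m))
    (sym (*-distribˡ-+ c (f 0 (suc m)) _))

  ∣-antidiagonalSum : ∀ {d} f m → (∀ k j → k ℕ.+ j ≡ m → d ∣ f k j) → d ∣ antidiagonalSum f m
  ∣-antidiagonalSum f zero d∣f = d∣f 0 0 refl
  ∣-antidiagonalSum f (suc m) d∣f = ∣m∣n⇒∣m+n (d∣f 0 (suc m) refl)
    (∣-antidiagonalSum (λ k j → f (suc k) j) m (λ k j e → d∣f (suc k) j (cong suc e)))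

  shiftʲ : (ℕ → ℕ → ℤ) → ℕ → ℕ → ℤ
  shiftʲ g k zero = 0ℤ
  shiftʲ g k (suc j) = g k j

  shift²ᵏ : (ℕ → ℕ → ℤ) → ℕ → ℕ → ℤ
  shift²ᵏ g zero j = 0ℤ
  shift²ᵏ g (suc zero) j = 0ℤ
  shift²ᵏ g (suc (suc k)) j = g k j

  antidiagonalSum-shiftʲ : ∀ g m → antidiagonalSum (shiftʲ g) (suc m) ≡ antidiagonalSum g m
  antidiagonalSum-shiftʲ g zero = +-identityʳ (g 0 0)
  antidiagonalSum-shiftʲ g (suc m) = cong (_+_ (g 0 (suc m))) (trans
    (antidiagonalSum-cong {λ k j → shiftʲ g (suc k) j} {shiftʲ (λ k j → g (suc k) j)} (suc m)
       λ { k zero _ → refl ; k (suc j) _ → refl })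
    (antidiagonalSum-shiftʲ (λ k j → g (suc k) j) m))

  antidiagonalSum-shift²ᵏ : ∀ g m → antidiagonalSum (shift²ᵏ g) (2 ℕ.+ m) ≡ antidiagonalSum g m
  antidiagonalSum-shift²ᵏ g m = trans (+-identityˡ _) (+-identityˡ _)

  weight : ℤ → ℕ → ℤ
  weight t n = + 2 * t * + (2 ℕ.* n ℕ.+ 1)

  record Recurrent (q t : ℤ) (x : ℕ → ℤ) : Set where
    constructor recurrent
    field recurrence : ∀ m → x (2 ℕ.+ m) ≡ weight t (2 ℕ.+ m) * x (1 ℕ.+ m) + q * x m

  rec-recurrent : ∀ s t a b → Recurrent (s * s) t (rec s t a b)
  rec-recurrent s t a b = recurrent λ m → refl

  recurrent-linear : ∀ {q t x y} K → Recurrent q t x → Recurrent q t y →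
                     Recurrent q t (λ n → x n + K * y n)
  recurrent-linear {q} {t} K (recurrent rx) (recurrent ry) = recurrent λ m →
    trans (cong₂ (λ u v → u + K * v) (rx m) (ry m)) (distribute (weight t (2 ℕ.+ m)) q K _ _ _ _)
    where
    distribute : ∀ c q K x₁ x₀ y₁ y₀ →
      (c * x₁ + q * x₀) + K * (c * y₁ + q * y₀) ≡ c * (x₁ + K * y₁) + q * (x₀ + K * y₀)
    distribute = solve-∀

  recurrent-unique : ∀ {q t x y} → Recurrent q t x → Recurrent q t y →
                     x 0 ≡ y 0 → x 1 ≡ y 1 → ∀ n → x n ≡ y n
  recurrent-unique {q} {t} {x} {y} (recurrent rx) (recurrent ry) x₀≡y₀ x₁≡y₁ = go
    where
    go : ∀ n → x n ≡ y n
    go zero = x₀≡y₀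
    go (suc zero) = x₁≡y₁
    go (suc (suc n)) = trans (rx n) (trans
      (cong₂ (λ u v → weight t (2 ℕ.+ n) * u + q * v) (go (suc n)) (go n))
      (sym (ry n)))

  term : ℤ → ℤ → ℕ → ℕ → ℤ
  term s t k j = + coeff k j * s ^ k * t ^ j

  closedForm : ℤ → ℤ → ℕ → ℤ
  closedForm s t = antidiagonalSum (term s t)

  pos-2*c*a : ∀ c a → + (2 ℕ.* c ℕ.* a) ≡ + 2 * + c * + a
  pos-2*c*a c a = trans (pos-* (2 ℕ.* c) a) (cong (_* + a) (pos-* 2 c))

  module _ (s t : ℤ) where
    tStep sStep : ℕ → ℕ → ℤ
    tStep k j = weight t (k ℕ.+ j) * term s t k j
    sStep k j = s * s * term s t k j

    -- A term of degree m + 2 comes from one of degree m + 1 times t and one of degree m times s².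
    term-split : ∀ m k j → k ℕ.+ j ≡ 2 ℕ.+ m → term s t k j ≡ shiftʲ tStep k j + shift²ᵏ sStep k j
    term-split m (suc (suc k)) zero _ = regroup s (s ^ k)
      where
      regroup : ∀ s S → + 1 * (s * (s * S)) * + 1 ≡ 0ℤ + s * s * (+ 1 * S * + 1)
      regroup = solve-∀
    term-split m zero (suc j) _ =
      trans (cong (λ z → z * + 1 * (t * t ^ j)) (pos-2*c*a (2 ℕ.* j ℕ.+ 1) (coeff 0 j)))
            (regroup t (+ (2 ℕ.* j ℕ.+ 1)) (+ coeff 0 j) (t ^ j))
      where
      regroup : ∀ t c a T → + 2 * c * a * + 1 * (t * T) ≡ + 2 * t * c * (a * + 1 * T) + 0ℤ
      regroup = solve-∀
    term-split m (suc zero) (suc j) _ =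
      trans (cong (λ z → z * (s * + 1) * (t * t ^ j)) (pos-2*c*a c (coeff 1 j)))
            (regroup s t (+ c) (+ coeff 1 j) (t ^ j))
      where
      c = 2 ℕ.* (1 ℕ.+ j) ℕ.+ 1
      regroup : ∀ s t c a T →
        + 2 * c * a * (s * + 1) * (t * T) ≡ + 2 * t * c * (a * (s * + 1) * T) + 0ℤ
      regroup = solve-∀
    term-split m (suc (suc k)) (suc j) _ =
      trans (cong (λ z → z * (s * (s * s ^ k)) * (t * t ^ j))
              (trans (pos-+ (2 ℕ.* c ℕ.* coeff (2 ℕ.+ k) j) (coeff k (suc j)))
                     (cong (_+ + coeff k (suc j)) (pos-2*c*a c (coeff (2 ℕ.+ k) j)))))
            (regroup s t (+ c) (+ coeff (2 ℕ.+ k) j) (+ coeff k (suc j)) (s ^ k) (t ^ j))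
      where
      c = 2 ℕ.* (2 ℕ.+ k ℕ.+ j) ℕ.+ 1
      regroup : ∀ s t c a₁ a₂ S T →
        (+ 2 * c * a₁ + a₂) * (s * (s * S)) * (t * T)
        ≡ + 2 * t * c * (a₁ * (s * (s * S)) * T) + s * s * (a₂ * S * (t * T))
      regroup = solve-∀

    closedForm-recurrence : ∀ m → closedForm s t (2 ℕ.+ m)
                                ≡ weight t (1 ℕ.+ m) * closedForm s t (1 ℕ.+ m) + s * s * closedForm s t m
    closedForm-recurrence m = begin
      antidiagonalSum (term s t) (2 ℕ.+ m)
        ≡⟨ antidiagonalSum-cong (2 ℕ.+ m) (term-split m) ⟩
      antidiagonalSum (λ k j → shiftʲ tStep k j + shift²ᵏ sStep k j) (2 ℕ.+ m)
        ≡⟨ antidiagonalSum-+ (shiftʲ tStep) (shift²ᵏ sStep) (2 ℕ.+ m) ⟩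
      antidiagonalSum (shiftʲ tStep) (2 ℕ.+ m) + antidiagonalSum (shift²ᵏ sStep) (2 ℕ.+ m)
        ≡⟨ cong₂ _+_ (antidiagonalSum-shiftʲ tStep (1 ℕ.+ m)) (antidiagonalSum-shift²ᵏ sStep m) ⟩
      antidiagonalSum tStep (1 ℕ.+ m) + antidiagonalSum sStep m
        ≡⟨ cong₂ _+_
             (trans (antidiagonalSum-cong (1 ℕ.+ m) λ k j k+j≡1+m →
                       cong (λ n → weight t n * term s t k j) k+j≡1+m)
                    (antidiagonalSum-* (weight t (1 ℕ.+ m)) (term s t) (1 ℕ.+ m)))
             (antidiagonalSum-* (s * s) (term s t) m) ⟩
      weight t (1 ℕ.+ m) * closedForm s t (1 ℕ.+ m) + s * s * closedForm s t m ∎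
      where open ≡-Reasoning

  closedForm-recurrent : ∀ s t → Recurrent (s * s) t (λ n → closedForm s t (suc n))
  closedForm-recurrent s t = recurrent λ m → closedForm-recurrence s t (suc m)

  A+[2t+s′]B≡closedForm : ∀ s s′ t → s′ * s′ ≡ s * s →
                          ∀ n → A s t n + (+ 2 * t + s′) * B s t n ≡ closedForm s′ t (suc n)
  A+[2t+s′]B≡closedForm s s′ t s′²≡s² = recurrent-unique
    (recurrent-linear (+ 2 * t + s′) (rec-recurrent s t (+ 0) (s * s)) (rec-recurrent s t (+ 1) (+ 6 * t)))
    (subst (λ q → Recurrent q t (λ n → closedForm s′ t (suc n))) s′²≡s² (closedForm-recurrent s′ t))
    (initial₀ s′ t)
    (trans (cong (_+ (+ 2 * t + s′) * (+ 6 * t)) (sym s′²≡s²)) (initial₁ s′ t))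
    where
    initial₀ : ∀ s t → + 0 + (+ 2 * t + s) * + 1 ≡ + 2 * + 1 * (t * + 1) + + 1 * (s * + 1) * + 1
    initial₀ = solve-∀
    initial₁ : ∀ s t → s * s + (+ 2 * t + s) * (+ 6 * t)
      ≡ + 12 * + 1 * (t * (t * + 1)) + (+ 6 * (s * + 1) * (t * + 1) + + 1 * (s * (s * + 1)) * + 1)
    initial₁ = solve-∀

  C⁺≡closedForm : ∀ s t n → C⁺ s t n ≡ closedForm s t (suc n)
  C⁺≡closedForm s t = A+[2t+s′]B≡closedForm s s t refl

  C⁻≡closedForm : ∀ s t n → C⁻ s t n ≡ closedForm (- s) t (suc n)
  C⁻≡closedForm s t = A+[2t+s′]B≡closedForm s (- s) t (-s*-s≡s*s s)
    where
    -s*-s≡s*s : ∀ s → - s * - s ≡ s * s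
    -s*-s≡s*s = solve-∀

module PrimeProducts where
  open import Data.Nat
  open import Data.Nat.Properties
  open import Data.Nat.Divisibility
  open import Data.Nat.Coprimality using (Coprime)
  open import Data.Nat.Primality
  open import Data.Bool using (if_then_else_; _∧_)
  open import Data.Product using (∃-syntax; _×_; _,_)
  open import Data.Sum using (_⊎_; inj₁; inj₂)
  open import Relation.Nullary using (¬_; Dec; does; yes; no)
  open import Relation.Binary.PropositionalEquality
  open import Defs using (r; v; prod)
  open PrimePowers
  open Coefficients

  OneOrPrimePower : (ℕ → ℕ) → Set
  OneOrPrimePower f = ∀ p → f p ≡ 1 ⊎ (Prime p × ∃[ e ] f p ≡ p ^ e)

  prime∤prod : ∀ {f q} → OneOrPrimePower f → Prime q → ∀ N → N < q → ¬ q ∣ prod f N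
  prime∤prod f-shape pq zero _ q∣1 = prime⇒¬∣1 pq q∣1
  prime∤prod {f} {q} f-shape pq (suc N) 1+N<q q∣
    with euclidsLemma (prod f N) (f (suc N)) pq q∣
  ... | inj₁ q∣prod = prime∤prod f-shape pq N (<-trans (n<1+n N) 1+N<q) q∣prod
  ... | inj₂ q∣f with f-shape (suc N)
  ...   | inj₁ f≡1 = prime⇒¬∣1 pq (subst (q ∣_) f≡1 q∣f)
  ...   | inj₂ (_ , e , f≡p^e) =
    <⇒≱ 1+N<q (∣⇒≤ (prime∣^⇒∣ (suc N) e pq (subst (q ∣_) f≡p^e q∣f)))

  prod-∣ : ∀ {f X} → OneOrPrimePower f → (∀ p → f p ∣ X) → ∀ N → prod f N ∣ X
  prod-∣ f-shape f∣X zero = 1∣ _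
  prod-∣ {f} f-shape f∣X (suc N) = coprime⇒*-∣ prod⊥f (prod-∣ f-shape f∣X N) (f∣X (suc N))
    where
    prod⊥f : Coprime (prod f N) (f (suc N))
    prod⊥f with f-shape (suc N)
    ... | inj₁ f≡1 = subst (Coprime (prod f N)) (sym f≡1) (λ (_ , d∣1) → ∣1⇒≡1 d∣1)
    ... | inj₂ (p , e , f≡p^e) =
      subst (Coprime (prod f N)) (sym f≡p^e) (¬∣⇒coprime-^ e p (prime∤prod f-shape p N ≤-refl))

  D-factor : ℕ → ℕ → ℕ → ℕ
  D-factor S n p = if does (prime? p) ∧ does (p ∣? S) then p ^ r p n else 1

  D-factor-cases : ∀ S n p → D-factor S n p ≡ 1 ⊎ (Prime p × p ∣ S × D-factor S n p ≡ p ^ r p n)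
  D-factor-cases S n p = cases (prime? p) (p ∣? S)
    where
    cases : (prime?p : Dec (Prime p)) (p∣?S : Dec (p ∣ S)) →
            let f = if does prime?p ∧ does p∣?S then p ^ r p n else 1
            in f ≡ 1 ⊎ (Prime p × p ∣ S × f ≡ p ^ r p n)
    cases (yes pp) (yes p∣S) = inj₂ (pp , p∣S , refl)
    cases (yes _) (no _) = inj₁ refl
    cases (no _) _ = inj₁ refl

  p^r∣coeff*S^k : ∀ {S n} k j p → Prime p → p ∣ S → k + j ≡ suc n → p ^ r p n ∣ coeff k j * S ^ k
  p^r∣coeff*S^k {S} {n} k j 2 _ 2∣S k+j≡1+n =
    subst (_∣ coeff k j * S ^ k) 2^j*2^k≡2^[1+n] (*-pres-∣ (2^j∣coeff k j) (^-monoˡ-∣ k 2∣S))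
    where
    2^j*2^k≡2^[1+n] : 2 ^ j * 2 ^ k ≡ 2 ^ suc n
    2^j*2^k≡2^[1+n] =
      trans (*-comm (2 ^ j) (2 ^ k)) (trans (sym (^-distribˡ-+-* 2 k j)) (cong (2 ^_) k+j≡1+n))
  p^r∣coeff*S^k {S} {n} k j p@(suc (suc (suc _))) pp p∣S k+j≡1+n = ∣-trans
    (p^e∣a*k!⇒p^e∣a*p^k pp {v p (suc n !)} {coeff k j} k p^r∣coeff*k!)
    (*-monoʳ-∣ (coeff k j) (^-monoˡ-∣ k p∣S))
    where
    p^r∣coeff*k! : p ^ r p n ∣ coeff k j * k !
    p^r∣coeff*k! = ∣-trans (p^valAux∣m (suc n !) p (suc n !))
                           (subst (λ m → m ! ∣ coeff k j * k !) k+j≡1+n ([k+j]!∣coeff*k! k j))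

  D-factor-oneOrPrimePower : ∀ S n → OneOrPrimePower (D-factor S n)
  D-factor-oneOrPrimePower S n p with D-factor-cases S n p
  ... | inj₁ f≡1 = inj₁ f≡1
  ... | inj₂ (pp , _ , f≡p^r) = inj₂ (pp , r p n , f≡p^r)

  D-factor∣coeff*S^k : ∀ {S n} k j → k + j ≡ suc n → ∀ p → D-factor S n p ∣ coeff k j * S ^ k
  D-factor∣coeff*S^k {S} {n} k j k+j≡1+n p with D-factor-cases S n p
  ... | inj₁ f≡1 = subst (_∣ _) (sym f≡1) (1∣ _)
  ... | inj₂ (pp , p∣S , f≡p^r) = subst (_∣ _) (sym f≡p^r) (p^r∣coeff*S^k k j p pp p∣S k+j≡1+n)

  prod-D-factor∣coeff*S^k : ∀ {S n} k j → k + j ≡ suc n →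
                            ∀ N → prod (D-factor S n) N ∣ coeff k j * S ^ k
  prod-D-factor∣coeff*S^k {S} {n} k j k+j≡1+n =
    prod-∣ (D-factor-oneOrPrimePower S n) (D-factor∣coeff*S^k k j k+j≡1+n)

module Divisibility where
  open import Data.Nat as ℕ using (ℕ)
  import Data.Nat.Divisibility as ℕ
  open import Data.Integer using (+_; _*_; _^_; -_; ∣_∣)
  open import Data.Integer.Properties using (abs-*; ∣-i∣≡∣i∣)
  open import Data.Integer.Divisibility using (_∣_)
  open import Data.Integer.Divisibility.Signed using (∣⇒∣ᵤ; ∣ᵤ⇒∣)
  open import Relation.Binary.PropositionalEquality
  open import Defs using (D; prod)
  open Coefficients using (coeff)
  open ClosedForm using (term; closedForm; ∣-antidiagonalSum)
  open PrimeProducts using (D-factor; prod-D-factor∣coeff*S^k)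

  abs-^ : ∀ i k → ∣ i ^ k ∣ ≡ ∣ i ∣ ℕ.^ k
  abs-^ i ℕ.zero = refl
  abs-^ i (ℕ.suc k) = trans (abs-* i (i ^ k)) (cong (∣ i ∣ ℕ.*_) (abs-^ i k))

  abs-term : ∀ s t k j → ∣ term s t k j ∣ ≡ coeff k j ℕ.* ∣ s ∣ ℕ.^ k ℕ.* ∣ t ^ j ∣
  abs-term s t k j = trans (abs-* (+ coeff k j * s ^ k) (t ^ j)) (cong (ℕ._* ∣ t ^ j ∣)
    (trans (abs-* (+ coeff k j) (s ^ k)) (cong (coeff k j ℕ.*_) (abs-^ s k))))

  D∣closedForm : ∀ s t n → + D s n ∣ closedForm s t (ℕ.suc n)
  D∣closedForm s t n = ∣⇒∣ᵤ {+ D s n} {closedForm s t (ℕ.suc n)}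
    (∣-antidiagonalSum (term s t) (ℕ.suc n) λ k j k+j≡1+n → ∣ᵤ⇒∣ {+ D s n} {term s t k j} (D∣term k j k+j≡1+n))
    where
    D∣term : ∀ k j → k ℕ.+ j ≡ ℕ.suc n → + D s n ∣ term s t k j
    D∣term k j k+j≡1+n = subst (D s n ℕ.∣_) (sym (abs-term s t k j))
      (ℕ.∣m⇒∣m*n ∣ t ^ j ∣ (prod-D-factor∣coeff*S^k k j k+j≡1+n ∣ s ∣))

  D-neg : ∀ s n → D (- s) n ≡ D s n
  D-neg s n = cong (λ S → prod (D-factor S n) S) (∣-i∣≡∣i∣ s)

open import Defs
open import Data.Nat using (ℕ)
open import Data.Integer using (ℤ; +_; 0ℤ; _≥_)
open import Data.Integer.Divisibility using (_∣_)
open import Data.Integer.GCD using (gcd)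
open import Relation.Binary.PropositionalEquality using (_≡_)
open import Relation.Nullary using (¬_)

open import Data.Integer using (-_)
open import Data.Integer.GCD using (gcd-greatest)
open import Relation.Binary.PropositionalEquality using (subst; subst₂; sym; cong)
open ClosedForm using (C⁺≡closedForm; C⁻≡closedForm)
open Divisibility using (D∣closedForm; D-neg)

lemma1 : (s t : ℤ) → ¬ (s ≡ 0ℤ) → t ≥ + 1 → gcd s t ≡ + 1 →
    (n : ℕ) → (+ D s n) ∣ gcd (C⁺ s t n) (C⁻ s t n)
lemma1 s t _ _ _ n = gcd-greatest {C⁺ s t n} {C⁻ s t n} {+ D s n}
  (subst (+ D s n ∣_) (sym (C⁺≡closedForm s t n)) (D∣closedForm s t n))
  (subst₂ _∣_ (cong +_ (D-neg s n)) (sym (C⁻≡closedForm s t n)) (D∣closedForm (- s) t n))
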